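{- Let $\Sigma$ be a signature, let $\varphi,\psi$ be quantified strictly positive formulas over $\Sigma$, let $x,y$ be variables, $t$ a term and $c$ a constant. Then the following hold in $\mathsf{QRC_1}$: (i) $\forall x\,\forall y\,\varphi \leadsto \forall y\,\forall x\,\varphi$; (ii) $\forall x\,\varphi \leadsto \varphi[x\leftarrow t]$, provided $t$ is free for $x$ in $\varphi$; (iii) $\Diamond \forall x\,\varphi \leadsto \forall x\,\Diamond\varphi$; (iv) $\forall x\,\varphi \leadsto \forall y\,\varphi[x\leftarrow y]$, provided $y$ is free for $x$ in $\varphi$ and $y\notin \mathrm{fv}(\varphi)$; (v) if $\varphi\leadsto\psi$, then $\varphi\leadsto\psi[x\leftarrow t]$, provided $x$ is not free in $\varphi$ and $t$ is free for $x$ in $\psi$; (vi) if $\varphi\leadsto\psi[x\leftarrow c]$, then $\varphi\leadsto\forall x\,\psi$, provided $x$ is not free in $\varphi$ and $c$ does not occur in $\varphi$ nor in $\psi$.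
   Context: A signature $\Sigma$ consists of a finite set of constant names, a finite set of predicate (relation) names, and an arity $n\in\mathbb{N}$ for each predicate name. Variables are the natural numbers. A term is a variable or a constant. Quantified strictly positive formulas are built by: $\top$; $S(t_0,\dots,t_{n-1})$ for an $n$-ary predicate $S$ and terms $t_i$; $\varphi\wedge\psi$; $\Diamond\varphi$; $\forall x\,\varphi$ for a variable $x$. $\mathrm{fv}(\varphi)$ denotes the set of free variables of $\varphi$. The substitution $\varphi[x\leftarrow t]$ replaces every free occurrence of the variable $x$ in $\varphi$ by the term $t$ (without renaming bound variables; it does not act beneath a binder $\forall x$). The term $t$ is free for $x$ in $\varphi$ if no free occurrence of $x$ in $\varphi$ lies within the scope of a quantifier $\forall y$ with $y$ a variable occurring in $t$ (i.e. no variable of $t$ becomes bound by the substitution). $\mathsf{QRC_1}$ derives sequents $\varphi\leadsto\psi$ by the following axioms and rules (for all formulas $\varphi,\psi,\chi$): (1) $\varphi\leadsto\top$ and $\varphi\leadsto\varphi$; (2) $\varphi\wedge\psi\leadsto\varphi$ and $\varphi\wedge\psi\leadsto\psi$; (3) if $\varphi\leadsto\psi$ and $\varphi\leadsto\chi$ then $\varphi\leadsto\psi\wedge\chi$; (4) if $\varphi\leadsto\psi$ and $\psi\leadsto\chi$ then $\varphi\leadsto\chi$; (5) if $\varphi\leadsto\psi$ then $\Diamond\varphi\leadsto\Diamond\psi$; (6) $\Diamond\Diamond\varphi\leadsto\Diamond\varphi$; (7) if $\varphi\leadsto\psi$ then $\varphi\leadsto\forall x\,\psi$, provided $x\notin\mathrm{fv}(\varphi)$;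 (8) if $\varphi[x\leftarrow t]\leadsto\psi$ then $\forall x\,\varphi\leadsto\psi$, provided $t$ is free for $x$ in $\varphi$; (9) if $\varphi\leadsto\psi$ then $\varphi[x\leftarrow t]\leadsto\psi[x\leftarrow t]$, provided $t$ is free for $x$ in $\varphi$ and in $\psi$; (10) if $\varphi[x\leftarrow c]\leadsto\psi[x\leftarrow c]$ then $\varphi\leadsto\psi$, provided the constant $c$ occurs neither in $\varphi$ nor in $\psi$. -}

module Defs where

open import Data.Nat using (ℕ; _≟_)
open import Data.Fin using (Fin)
open import Data.Vec using (Vec; map)
open import Data.Vec.Membership.Propositional using () renaming (_∈_ to _∈ᵥ_)
open import Data.Product using (_×_; Σ-syntax)
open import Data.Sum using (_⊎_)
open import Relation.Nullary using (¬_; yes; no)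
open import Relation.Binary.PropositionalEquality using (_≡_)

record Signature : Set where
  field
    nConst : ℕ
    nPred  : ℕ
    arity  : Fin nPred → ℕ

module _ (Σ : Signature) where
  open Signature Σ

  Var : Set
  Var = ℕ

  Const : Set
  Const = Fin nConst

  data Term : Set where
    var   : Var → Term
    const : Const → Term

  data Formula : Set where
    ⊤'   : Formula
    pred : (S : Fin nPred) → Vec Term (arity S) → Formula
    _∧'_ : Formula → Formula → Formula
    ◇_   : Formula → Formula
    ∀'   : Var → Formula → Formula

  data VarIn (x : Var) : Term → Set where
    here : VarIn x (var x)

  data Free (x : Var) : Formula → Set where
    free-pred : ∀ {S ts t} → t ∈ᵥ ts → VarIn x t → Free x (pred S ts)
    free-∧ˡ   : ∀ {φ ψ} → Free x φ → Free x (φ ∧' ψ)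
    free-∧ʳ   : ∀ {φ ψ} → Free x ψ → Free x (φ ∧' ψ)
    free-◇    : ∀ {φ} → Free x φ → Free x (◇ φ)
    free-∀    : ∀ {y φ} → ¬ (x ≡ y) → Free x φ → Free x (∀' y φ)

  data ConstOcc (c : Const) : Formula → Set where
    occ-pred : ∀ {S ts} → const c ∈ᵥ ts → ConstOcc c (pred S ts)
    occ-∧ˡ   : ∀ {φ ψ} → ConstOcc c φ → ConstOcc c (φ ∧' ψ)
    occ-∧ʳ   : ∀ {φ ψ} → ConstOcc c ψ → ConstOcc c (φ ∧' ψ)
    occ-◇    : ∀ {φ} → ConstOcc c φ → ConstOcc c (◇ φ)
    occ-∀    : ∀ {y φ} → ConstOcc c φ → ConstOcc c (∀' y φ)

  substTerm : Term → Var → Term → Term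
  substTerm (var y) x t with y ≟ x
  ... | yes _ = t
  ... | no  _ = var y
  substTerm (const c) x t = const c

  _[_←_] : Formula → Var → Term → Formula
  ⊤' [ x ← t ] = ⊤'
  pred S ts [ x ← t ] = pred S (map (λ u → substTerm u x t) ts)
  (φ ∧' ψ) [ x ← t ] = (φ [ x ← t ]) ∧' (ψ [ x ← t ])
  (◇ φ) [ x ← t ] = ◇ (φ [ x ← t ])
  ∀' y φ [ x ← t ] with y ≟ x
  ... | yes _ = ∀' y φ
  ... | no  _ = ∀' y (φ [ x ← t ])

  data FreeFor (t : Term) (x : Var) : Formula → Set where
    ff-⊤    : FreeFor t x ⊤'
    ff-pred : ∀ {S ts} → FreeFor t x (pred S ts)
    ff-∧    : ∀ {φ ψ} → FreeFor t x φ → FreeFor t x ψ → FreeFor t x (φ ∧' ψ)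
    ff-◇    : ∀ {φ} → FreeFor t x φ → FreeFor t x (◇ φ)
    ff-∀-nofree : ∀ {y φ} → ¬ Free x (∀' y φ) → FreeFor t x (∀' y φ)
    ff-∀    : ∀ {y φ} → ¬ VarIn y t → FreeFor t x φ → FreeFor t x (∀' y φ)

  infix 4 _⇝_
  data _⇝_ : Formula → Formula → Set where
    top    : ∀ {φ} → φ ⇝ ⊤'
    refl'  : ∀ {φ} → φ ⇝ φ
    ∧-elˡ  : ∀ {φ ψ} → (φ ∧' ψ) ⇝ φ
    ∧-elʳ  : ∀ {φ ψ} → (φ ∧' ψ) ⇝ ψ
    ∧-intro : ∀ {φ ψ χ} → φ ⇝ ψ → φ ⇝ χ → φ ⇝ (ψ ∧' χ)
    cut    : ∀ {φ ψ χ} → φ ⇝ ψ → ψ ⇝ χ → φ ⇝ χ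
    nec    : ∀ {φ ψ} → φ ⇝ ψ → ◇ φ ⇝ ◇ ψ
    trans◇ : ∀ {φ} → ◇ (◇ φ) ⇝ ◇ φ
    ∀-intro : ∀ {φ ψ x} → ¬ Free x φ → φ ⇝ ψ → φ ⇝ ∀' x ψ
    ∀-elim : ∀ {φ ψ x t} → FreeFor t x φ → (φ [ x ← t ]) ⇝ ψ → ∀' x φ ⇝ ψ
    term-inst : ∀ {φ ψ x t} → FreeFor t x φ → FreeFor t x ψ →
                φ ⇝ ψ → (φ [ x ← t ]) ⇝ (ψ [ x ← t ])
    const-elim : ∀ {φ ψ x c} → ¬ ConstOcc c φ → ¬ ConstOcc c ψ →
                 (φ [ x ← const c ]) ⇝ (ψ [ x ← const c ]) → φ ⇝ ψ

{-# OPTIONS --safe #-}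
-- Every part is a short derivation from the ∀-rules once two syntactic facts
-- are available: substituting x for itself is the identity, and substituting
-- for a variable that is not free changes nothing. The first yields
-- ∀ x φ ⇝ φ, which with ∀-introduction gives (i) and (iii); (ii) and (iv)
-- are ∀-elimination, (v) generalises and then instantiates, and (vi) uses
-- that φ[x ← c] = φ to apply the constant rule.
module Submission where

open import Defs
open import Data.Empty using (⊥-elim)
open import Data.Nat using (_≟_)
open import Data.Product using (_×_; _,_)
open import Data.Vec using (Vec; []; _∷_; map)
open import Data.Vec.Membership.Propositional using (_∈_)
open import Data.Vec.Properties using (map-cong; map-id)
open import Data.Vec.Relation.Unary.Any using (here; there)
open import Function using (_∘_)
open import Relation.Nullary using (¬_; yes; no)
open import Relation.Binary.PropositionalEquality using (_≡_; refl; cong; cong₂; sym; trans; subst)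

module _ (Σ : Signature) where

  infix 4 _⊢_
  _⊢_ : Formula Σ → Formula Σ → Set
  _⊢_ = _⇝_ Σ

  _⟨_≔_⟩ : Formula Σ → Var Σ → Term Σ → Formula Σ
  _⟨_≔_⟩ = _[_←_] Σ

  substTerm-self : ∀ u x → substTerm Σ u x (var x) ≡ u
  substTerm-self (var y) x with y ≟ x
  ... | yes refl = refl
  ... | no _ = refl
  substTerm-self (const c) x = refl

  subst-self : ∀ φ x → φ ⟨ x ≔ var x ⟩ ≡ φ
  subst-self ⊤' x = refl
  subst-self (pred S ts) x = cong (pred S) (trans (map-cong (λ u → substTerm-self u x) ts) (map-id ts))
  subst-self (φ ∧' ψ) x = cong₂ _∧'_ (subst-self φ x) (subst-self ψ x)
  subst-self (◇ φ) x = cong ◇_ (subst-self φ x)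
  subst-self (∀' y φ) x with y ≟ x
  ... | yes _ = refl
  ... | no _ = cong (∀' y) (subst-self φ x)

  map-substTerm-fresh : ∀ {n} (ts : Vec (Term Σ) n) x t →
    (∀ {u} → u ∈ ts → ¬ VarIn Σ x u) → map (λ u → substTerm Σ u x t) ts ≡ ts
  map-substTerm-fresh [] x t fresh = refl
  map-substTerm-fresh (var y ∷ ts) x t fresh with y ≟ x
  ... | yes refl = ⊥-elim (fresh (here refl) here)
  ... | no _ = cong (var y ∷_) (map-substTerm-fresh ts x t (fresh ∘ there))
  map-substTerm-fresh (const c ∷ ts) x t fresh = cong (const c ∷_) (map-substTerm-fresh ts x t (fresh ∘ there))

  subst-fresh : ∀ φ x t → ¬ Free Σ x φ → φ ⟨ x ≔ t ⟩ ≡ φ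
  subst-fresh ⊤' x t x∉φ = refl
  subst-fresh (pred S ts) x t x∉φ = cong (pred S) (map-substTerm-fresh ts x t (λ u∈ts → x∉φ ∘ free-pred u∈ts))
  subst-fresh (φ ∧' ψ) x t x∉φ = cong₂ _∧'_ (subst-fresh φ x t (x∉φ ∘ free-∧ˡ)) (subst-fresh ψ x t (x∉φ ∘ free-∧ʳ))
  subst-fresh (◇ φ) x t x∉φ = cong ◇_ (subst-fresh φ x t (x∉φ ∘ free-◇))
  subst-fresh (∀' y φ) x t x∉φ with y ≟ x
  ... | yes _ = refl
  ... | no y≢x = cong (∀' y) (subst-fresh φ x t (x∉φ ∘ free-∀ (y≢x ∘ sym)))

  freeFor-self : ∀ φ x → FreeFor Σ (var x) x φ
  freeFor-self ⊤' x = ff-⊤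
  freeFor-self (pred S ts) x = ff-pred
  freeFor-self (φ ∧' ψ) x = ff-∧ (freeFor-self φ x) (freeFor-self ψ x)
  freeFor-self (◇ φ) x = ff-◇ (freeFor-self φ x)
  freeFor-self (∀' y φ) x with y ≟ x
  ... | yes refl = ff-∀-nofree (λ { (free-∀ x≢x _) → x≢x refl })
  ... | no y≢x = ff-∀ (λ { here → y≢x refl }) (freeFor-self φ x)

  bound-not-free : ∀ x φ → ¬ Free Σ x (∀' x φ)
  bound-not-free x φ (free-∀ x≢x _) = x≢x refl

  ∀-inst : ∀ {φ x t} → FreeFor Σ t x φ → ∀' x φ ⊢ φ ⟨ x ≔ t ⟩
  ∀-inst t-free = ∀-elim t-free refl'

  ∀-drop : ∀ φ x → ∀' x φ ⊢ φ
  ∀-drop φ x = subst (∀' x φ ⊢_) (subst-self φ x) (∀-inst (freeFor-self φ x))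

  ∀-comm : ∀ φ x y → ∀' x (∀' y φ) ⊢ ∀' y (∀' x φ)
  ∀-comm φ x y =
    ∀-intro (λ { (free-∀ _ y-free) → bound-not-free y φ y-free })
      (∀-intro (bound-not-free x (∀' y φ)) (cut (∀-drop (∀' y φ) x) (∀-drop φ y)))

  ◇∀⇝∀◇ : ∀ φ x → ◇ (∀' x φ) ⊢ ∀' x (◇ φ)
  ◇∀⇝∀◇ φ x = ∀-intro (λ { (free-◇ x-free) → bound-not-free x φ x-free }) (nec (∀-drop φ x))

  ∀-rename : ∀ φ x y → FreeFor Σ (var y) x φ → ¬ Free Σ y φ → ∀' x φ ⊢ ∀' y (φ ⟨ x ≔ var y ⟩)
  ∀-rename φ x y y-free y∉φ = ∀-intro (λ { (free-∀ _ y∈φ) → y∉φ y∈φ }) (∀-inst y-free)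

  ⊢-subst-right : ∀ {φ ψ} x t → ¬ Free Σ x φ → FreeFor Σ t x ψ → φ ⊢ ψ → φ ⊢ ψ ⟨ x ≔ t ⟩
  ⊢-subst-right x t x∉φ t-free φ⊢ψ = cut (∀-intro x∉φ φ⊢ψ) (∀-inst t-free)

  ∀-intro-const : ∀ {φ ψ} x c → ¬ Free Σ x φ → ¬ ConstOcc Σ c φ → ¬ ConstOcc Σ c ψ →
    φ ⊢ ψ ⟨ x ≔ const c ⟩ → φ ⊢ ∀' x ψ
  ∀-intro-const {φ} {ψ} x c x∉φ c∉φ c∉ψ φ⊢ψc =
    ∀-intro x∉φ (const-elim c∉φ c∉ψ (subst (_⊢ ψ ⟨ x ≔ const c ⟩) (sym (subst-fresh φ x (const c) x∉φ)) φ⊢ψc))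

lemma3p2 : (Σ : Signature) →
    ((φ : Formula Σ) (x y : Var Σ) →
      _⇝_ Σ (∀' x (∀' y φ)) (∀' y (∀' x φ)))
    × ((φ : Formula Σ) (x : Var Σ) (t : Term Σ) → FreeFor Σ t x φ →
      _⇝_ Σ (∀' x φ) (_[_←_] Σ φ x t))
    × ((φ : Formula Σ) (x : Var Σ) →
      _⇝_ Σ (◇ (∀' x φ)) (∀' x (◇ φ)))
    × ((φ : Formula Σ) (x y : Var Σ) → FreeFor Σ (var y) x φ → ¬ Free Σ y φ →
      _⇝_ Σ (∀' x φ) (∀' y (_[_←_] Σ φ x (var y))))
    × ((φ ψ : Formula Σ) (x : Var Σ) (t : Term Σ) → ¬ Free Σ x φ → FreeFor Σ t x ψ →
      _⇝_ Σ φ ψ → _⇝_ Σ φ (_[_←_] Σ ψ x t))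
    × ((φ ψ : Formula Σ) (x : Var Σ) (c : Const Σ) → ¬ Free Σ x φ →
      ¬ ConstOcc Σ c φ → ¬ ConstOcc Σ c ψ →
      _⇝_ Σ φ (_[_←_] Σ ψ x (const c)) → _⇝_ Σ φ (∀' x ψ))
lemma3p2 Σ =
    ∀-comm Σ
  , (λ φ x t → ∀-inst Σ)
  , ◇∀⇝∀◇ Σ
  , ∀-rename Σ
  , (λ φ ψ → ⊢-subst-right Σ)
  , (λ φ ψ → ∀-intro-const Σ)
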